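{- Let $G$ be a graph and let $C=v_0v_1\ldots v_{n-1}$ be an induced cycle of $G$ of length $n\geq 5$ with good neighbors. For $i=0,\ldots,n-1$ let $B_i$ be a biclique of $G$ containing the vertices $\{v_{i-1},v_i,v_{i+1}\}$ (indices mod $n$), and let $b_i$ be the vertex of $KB_e(G)$ corresponding to $B_i$. Then $V(B_i)\subseteq N[v_i]$ for every $i$, $C'=b_0b_1\ldots b_{n-1}$ is an induced cycle of $KB_e(G)$, and $C'$ has good neighbors in $KB_e(G)$.
   Context: All graphs are finite, simple and undirected. A biclique of a graph $G$ is a maximal induced complete bipartite subgraph of $G$. The edge-biclique graph $KB_e(G)$ has one vertex for each biclique of $G$, two vertices being adjacent when the corresponding bicliques share at least one edge. $N[v]$ is the closed neighborhood of $v$. An induced cycle $C=v_0\ldots v_{n-1}$ ($n\ge 5$) of a graph $H$ has good neighbors if for every vertex $v\in V(H)\setminus V(C)$ and every $i$ (indices mod $n$), if $v$ is adjacent to both $v_{i-1}$ and $v_{i+1}$ then $v$ is adjacent to $v_i$. -}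

module Defs where

open import Data.Nat using (ℕ; zero; suc; _+_; _%_)
open import Data.Nat.DivMod using (m%n<n)
open import Data.Fin using (Fin; toℕ; fromℕ<)
open import Data.Fin.Subset using (Subset; _∈_; _∉_; _⊆_; _∪_; Nonempty)
open import Data.Product using (Σ; ∃; _×_; _,_)
open import Data.Sum using (_⊎_)
open import Data.Unit using (⊤)
open import Relation.Nullary using (¬_; Dec)
open import Relation.Binary.PropositionalEquality using (_≡_; _≢_)

record Graph : Set₁ where
  field
    m     : ℕ
    Adj   : Fin m → Fin m → Set
    sym   : ∀ {u v} → Adj u v → Adj v u
    irr   : ∀ {u} → ¬ Adj u u
    dec   : ∀ u v → Dec (Adj u v)
open Graph public

next : ∀ {n} → Fin n → Fin n
next {suc n} i = fromℕ< (m%n<n (suc (toℕ i)) (suc n))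

prev : ∀ {n} → Fin n → Fin n
prev {suc n} i = fromℕ< (m%n<n (toℕ i + n) (suc n))

N[_]∋_ : (G : Graph) → Fin (m G) → Fin (m G) → Set
(N[ G ]∋ v) u = u ≡ v ⊎ Adj G u v

InducesCompleteBipartite : (G : Graph) → Subset (m G) → Set
InducesCompleteBipartite G S =
  Σ (Subset (m G)) λ X → Σ (Subset (m G)) λ Y →
    (S ≡ X ∪ Y) × Nonempty X × Nonempty Y ×
    (∀ {u v} → u ∈ X → v ∈ X → ¬ Adj G u v) ×
    (∀ {u v} → u ∈ Y → v ∈ Y → ¬ Adj G u v) ×
    (∀ {u v} → u ∈ X → v ∈ Y → Adj G u v)

IsBiclique : (G : Graph) → Subset (m G) → Set
IsBiclique G S =
  InducesCompleteBipartite G S ×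
  (∀ T → S ⊆ T → InducesCompleteBipartite G T → T ≡ S)

record GraphOn : Set₁ where
  field
    V     : Set
    Vert  : V → Set
    Adjᴴ  : V → V → Set
open GraphOn public

asGraphOn : Graph → GraphOn
asGraphOn G = record { V = Fin (m G) ; Vert = λ _ → ⊤ ; Adjᴴ = Adj G }

ShareEdge : (G : Graph) → Subset (m G) → Subset (m G) → Set
ShareEdge G S T =
  ∃ λ u → ∃ λ w → u ∈ S × w ∈ S × u ∈ T × w ∈ T × Adj G u w

KBe : Graph → GraphOn
KBe G = record
  { V    = Subset (m G)
  ; Vert = IsBiclique G
  ; Adjᴴ = λ S T → S ≢ T × ShareEdge G S T
  }

record IsInducedCycle (H : GraphOn) {n : ℕ} (c : Fin n → V H) : Set where
  field
    vert   : ∀ i → Vert H (c i)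
    inj    : ∀ i j → c i ≡ c j → i ≡ j
    adj    : ∀ i → Adjᴴ H (c i) (c (next i))
    nonadj : ∀ i j → i ≢ j → j ≢ next i → i ≢ next j →
             ¬ Adjᴴ H (c i) (c j)

HasGoodNeighbors : (H : GraphOn) {n : ℕ} (c : Fin n → V H) → Set
HasGoodNeighbors H {n} c =
  ∀ v → Vert H v → (∀ j → v ≢ c j) → ∀ i →
    Adjᴴ H v (c (prev i)) → Adjᴴ H v (c (next i)) → Adjᴴ H v (c i)

-- Each B i is a star centred at c i.  Indeed c (i - 1) and c (i + 1) lie
-- on the side of B i opposite to c i, so any other vertex on the side of
-- c i is a common neighbour of c (i - 1) and c (i + 1); on the cycle that
-- vertex can only be c i (the cycle has length at least 5), and off the
-- cycle good neighbours make it adjacent to c i, contradicting independence.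
-- Hence every edge of B i passes through c i, and B i, B j share an edge
-- only if c i, c j are equal or adjacent: the B i form an induced cycle.
-- A biclique S sharing edges with B (i - 1) and B (i + 1) contains c (i - 1),
-- c (i + 1) and a neighbour x of c (i - 1) in B (i - 1); as c (i - 1) and
-- c (i + 1) are nonadjacent they lie on one side of S, so x is adjacent to
-- both, which forces x ≡ c i and S shares the edge c (i - 1) c i with B i.

module Submission where

open import Defs
open import Data.Nat using (ℕ; _≥_; zero; suc; _+_; _*_; _%_; _/_; _<_; _≤_; s≤s; z≤n; z<s; NonZero; >-nonZero)
open import Data.Nat.Properties using (+-suc; +-comm; +-identityʳ; +-cancelˡ-≡; <⇒≱; ≤-refl; ≤-trans)
open import Data.Nat.DivMod using (%-distribˡ-+; m%n%n≡m%n; [m+n]%n≡m%n; m<n⇒m%n≡m; m≡m%n+[m/n]*n)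
open import Data.Nat.Divisibility using (divides; ∣⇒≤)
open import Data.Nat.GeneralisedArithmetic using (fold; fold-+)
open import Data.Fin using (Fin; toℕ; _≟_)
open import Data.Fin.Properties using (toℕ-fromℕ<; toℕ-injective; toℕ<n; any?)
open import Data.Fin.Subset using (Subset; _∈_)
open import Data.Fin.Subset.Properties using (x∈p∪q⁻)
open import Data.Product using (_×_; _,_; ∃; proj₁; proj₂)
open import Data.Sum as Sum using (_⊎_; inj₁; inj₂)
open import Data.Empty using (⊥-elim)
open import Data.Unit using (tt)
open import Function using (_∘_)
open import Relation.Nullary using (¬_; yes; no)
open import Relation.Binary.PropositionalEquality as ≡ using (_≡_; _≢_; refl; trans; cong; module ≡-Reasoning)
open ≡-Reasoning

[m+n%d]%d≡[m+n]%d : ∀ a b d .{{_ : NonZero d}} → (a + b % d) % d ≡ (a + b) % d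
[m+n%d]%d≡[m+n]%d a b d = begin
  (a + b % d) % d         ≡⟨ %-distribˡ-+ a (b % d) d ⟩
  (a % d + b % d % d) % d ≡⟨ cong (λ t → (a % d + t) % d) (m%n%n≡m%n b d) ⟩
  (a % d + b % d) % d     ≡⟨ %-distribˡ-+ a b d ⟨
  (a + b) % d             ∎

[m+n]%d≢m : ∀ a {j} d .{{_ : NonZero d}} → 0 < j → j < d → (a + j) % d ≢ a
[m+n]%d≢m a {j} d 0<j j<d eq = <⇒≱ j<d (∣⇒≤ {{>-nonZero 0<j}} (divides q j≡q*d))
  where
  q = (a + j) / d
  j≡q*d : j ≡ q * d
  j≡q*d = +-cancelˡ-≡ a j (q * d) (trans (m≡m%n+[m/n]*n (a + j) d) (cong (_+ q * d) eq))

module CyclicOrder (k : ℕ) where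

  toℕ-fold-next : ∀ (i : Fin (suc k)) j → toℕ (fold i next j) ≡ (toℕ i + j) % suc k
  toℕ-fold-next i zero = begin
    toℕ i               ≡⟨ m<n⇒m%n≡m (toℕ<n i) ⟨
    toℕ i % suc k       ≡⟨ cong (_% suc k) (+-identityʳ (toℕ i)) ⟨
    (toℕ i + 0) % suc k ∎
  toℕ-fold-next i (suc j) = begin
    toℕ (next (fold i next j))        ≡⟨ toℕ-fromℕ< _ ⟩
    suc (toℕ (fold i next j)) % suc k ≡⟨ cong (λ t → suc t % suc k) (toℕ-fold-next i j) ⟩
    (1 + (toℕ i + j) % suc k) % suc k ≡⟨ [m+n%d]%d≡[m+n]%d 1 (toℕ i + j) (suc k) ⟩
    suc (toℕ i + j) % suc k           ≡⟨ cong (_% suc k) (+-suc (toℕ i) j) ⟨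
    (toℕ i + suc j) % suc k           ∎

  fold-next-period : ∀ i → fold i next (suc k) ≡ i
  fold-next-period i = toℕ-injective (begin
    toℕ (fold i next (suc k)) ≡⟨ toℕ-fold-next i (suc k) ⟩
    (toℕ i + suc k) % suc k   ≡⟨ [m+n]%n≡m%n (toℕ i) (suc k) ⟩
    toℕ i % suc k             ≡⟨ m<n⇒m%n≡m (toℕ<n i) ⟩
    toℕ i                     ∎)

  fold-next-≢ : ∀ i {j} → 0 < j → j < suc k → fold i next j ≢ i
  fold-next-≢ i {j} 0<j j<n eq = [m+n]%d≢m (toℕ i) (suc k) 0<j j<n (trans (≡.sym (toℕ-fold-next i j)) (cong toℕ eq))

  prev≡fold-next : ∀ i → prev i ≡ fold i next k
  prev≡fold-next i = toℕ-injective (trans (toℕ-fromℕ< _) (≡.sym (toℕ-fold-next i k)))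

  next-prev : ∀ i → next (prev i) ≡ i
  next-prev i = trans (cong next (prev≡fold-next i)) (fold-next-period i)

  prev-next : ∀ i → prev (next i) ≡ i
  prev-next i = begin
    prev (next i)            ≡⟨ prev≡fold-next (next i) ⟩
    fold (next i) next k     ≡⟨ fold-+ i next k ⟨
    fold i next (k + 1)      ≡⟨ cong (fold i next) (+-comm k 1) ⟩
    fold i next (suc k)      ≡⟨ fold-next-period i ⟩
    i                        ∎

  next-injective : ∀ {i j} → next i ≡ next j → i ≡ j
  next-injective {i} {j} eq = trans (≡.sym (prev-next i)) (trans (cong prev eq) (prev-next j))

-- Only S ⊆ left ∪ right is recorded.
record Bipartition (G : Graph) (S : Subset (m G)) : Set where
  field
    left right          : Subset (m G)
    covers              : ∀ {u} → u ∈ S → u ∈ left ⊎ u ∈ right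
    left-independent    : ∀ {u w} → u ∈ left → w ∈ left → ¬ Adj G u w
    right-independent   : ∀ {u w} → u ∈ right → w ∈ right → ¬ Adj G u w
    left-right-adjacent : ∀ {u w} → u ∈ left → w ∈ right → Adj G u w

record IsStarAt (G : Graph) (S : Subset (m G)) (v : Fin (m G)) : Set where
  field
    ⊆-N                  : ∀ {u} → u ∈ S → (N[ G ]∋ v) u
    edges-through-centre : ∀ {u w} → u ∈ S → w ∈ S → Adj G u w → u ≡ v ⊎ w ≡ v

module _ {G : Graph} {S : Subset (m G)} where

  bipartition : InducesCompleteBipartite G S → Bipartition G S
  bipartition (X , Y , S≡X∪Y , _ , _ , X-indep , Y-indep , X-Y-adj) = record
    { left                = X
    ; right               = Y
    ; covers              = λ {u} u∈S → x∈p∪q⁻ X Y (≡.subst (u ∈_) S≡X∪Y u∈S)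
    ; left-independent    = X-indep
    ; right-independent   = Y-indep
    ; left-right-adjacent = X-Y-adj
    }

  flip : Bipartition G S → Bipartition G S
  flip P = record
    { left                = right
    ; right               = left
    ; covers              = Sum.swap ∘ covers
    ; left-independent    = right-independent
    ; right-independent   = left-independent
    ; left-right-adjacent = λ u∈right w∈left → sym G (left-right-adjacent w∈left u∈right)
    }
    where open Bipartition P

module _ {G : Graph} {S : Subset (m G)} (P : Bipartition G S) where
  open Bipartition P

  adj-¬adj⇒adj : ∀ {a b d} → a ∈ S → b ∈ S → d ∈ S → Adj G a b → ¬ Adj G b d → Adj G a d
  adj-¬adj⇒adj a∈S b∈S d∈S a~b b≁d with covers a∈S | covers b∈S | covers d∈S
  ... | inj₁ a∈L | inj₁ b∈L | _        = ⊥-elim (left-independent a∈L b∈L a~b)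
  ... | inj₂ a∈R | inj₂ b∈R | _        = ⊥-elim (right-independent a∈R b∈R a~b)
  ... | inj₁ _   | inj₂ b∈R | inj₁ d∈L = ⊥-elim (b≁d (sym G (left-right-adjacent d∈L b∈R)))
  ... | inj₁ a∈L | inj₂ _   | inj₂ d∈R = left-right-adjacent a∈L d∈R
  ... | inj₂ a∈R | inj₁ _   | inj₁ d∈L = sym G (left-right-adjacent d∈L a∈R)
  ... | inj₂ _   | inj₁ b∈L | inj₂ d∈R = ⊥-elim (b≁d (left-right-adjacent b∈L d∈R))

  module _ {v} (v∈R : v ∈ right) where

    neighbour∈left : ∀ {u} → u ∈ S → Adj G u v → u ∈ left
    neighbour∈left u∈S u~v with covers u∈S
    ... | inj₁ u∈L = u∈L
    ... | inj₂ u∈R = ⊥-elim (right-independent u∈R v∈R u~v)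

    right-singleton⇒star : (∀ {u} → u ∈ right → u ≡ v) → IsStarAt G S v
    right-singleton⇒star R≡v = record
      { ⊆-N                  = λ u∈S → Sum.map R≡v (λ u∈L → left-right-adjacent u∈L v∈R) (Sum.swap (covers u∈S))
      ; edges-through-centre = through
      }
      where
      through : ∀ {u w} → u ∈ S → w ∈ S → Adj G u w → u ≡ v ⊎ w ≡ v
      through u∈S w∈S u~w with covers u∈S | covers w∈S
      ... | inj₂ u∈R | _        = inj₁ (R≡v u∈R)
      ... | inj₁ _   | inj₂ w∈R = inj₂ (R≡v w∈R)
      ... | inj₁ u∈L | inj₁ w∈L = ⊥-elim (left-independent u∈L w∈L u~w)

    common-neighbours⇒star : ∀ {p q} → p ∈ S → q ∈ S → Adj G p v → Adj G q v →
      (∀ {u} → Adj G u p → Adj G u q → u ≡ v ⊎ Adj G u v) → IsStarAt G S v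
    common-neighbours⇒star p∈S q∈S p~v q~v common = right-singleton⇒star R≡v
      where
      R≡v : ∀ {u} → u ∈ right → u ≡ v
      R≡v u∈R with common (sym G (left-right-adjacent (neighbour∈left p∈S p~v) u∈R))
                          (sym G (left-right-adjacent (neighbour∈left q∈S q~v) u∈R))
      ... | inj₁ u≡v = u≡v
      ... | inj₂ u~v = ⊥-elim (right-independent u∈R v∈R u~v)

completeBipartite⇒star : ∀ {G S v p q} → InducesCompleteBipartite G S →
  v ∈ S → p ∈ S → q ∈ S → Adj G p v → Adj G q v →
  (∀ {u} → Adj G u p → Adj G u q → u ≡ v ⊎ Adj G u v) → IsStarAt G S v
completeBipartite⇒star S-cb v∈S with P ← bipartition S-cb | Bipartition.covers P v∈S
... | inj₁ v∈L = common-neighbours⇒star (flip P) v∈L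
... | inj₂ v∈R = common-neighbours⇒star P v∈R

module _ {G : Graph} {S : Subset (m G)} {v : Fin (m G)} (star : IsStarAt G S v) where
  open IsStarAt star

  leaves-nonadjacent : ∀ {u w} → u ∈ S → w ∈ S → Adj G u v → Adj G w v → ¬ Adj G u w
  leaves-nonadjacent u∈S w∈S u~v w~v u~w with edges-through-centre u∈S w∈S u~w
  ... | inj₁ refl = irr G u~v
  ... | inj₂ refl = irr G w~v

  shared-edge⇒centre : ∀ {T} → ShareEdge G T S →
    ∃ λ x → (x ∈ T × x ∈ S × Adj G x v) × v ∈ T
  shared-edge⇒centre (u , w , u∈T , w∈T , u∈S , w∈S , u~w) with edges-through-centre u∈S w∈S u~w
  ... | inj₁ refl = w , (w∈T , w∈S , sym G u~w) , u∈T
  ... | inj₂ refl = u , (u∈T , u∈S , u~w) , w∈T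

two-neighbours⇒centre : ∀ {G S v w p q} → IsStarAt G S w → v ∈ S → p ∈ S → q ∈ S →
  Adj G p v → Adj G q v → p ≢ q → v ≡ w
two-neighbours⇒centre star v∈S p∈S q∈S p~v q~v p≢q
  with IsStarAt.edges-through-centre star p∈S v∈S p~v
     | IsStarAt.edges-through-centre star q∈S v∈S q~v
... | inj₂ v≡w | _        = v≡w
... | inj₁ _   | inj₂ v≡w = v≡w
... | inj₁ p≡w | inj₁ q≡w = ⊥-elim (p≢q (trans p≡w (≡.sym q≡w)))

shared-edge-of-stars : ∀ {G S T v w} → IsStarAt G S v → IsStarAt G T w →
  ShareEdge G S T → v ≡ w ⊎ Adj G v w
shared-edge-of-stars S-star T-star share with shared-edge⇒centre T-star share
... | x , (x∈S , _ , x~w) , w∈S with IsStarAt.edges-through-centre S-star x∈S w∈S x~w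
...   | inj₁ refl = inj₂ x~w
...   | inj₂ refl = inj₁ refl

module InducedCycle (G : Graph) (k : ℕ) (4≤k : 4 ≤ k) {c : Fin (suc k) → Fin (m G)}
                    (cycle : IsInducedCycle (asGraphOn G) c) where
  open CyclicOrder k public
  open IsInducedCycle cycle

  next^≢ : ∀ {j} i → 0 < j → j ≤ 4 → fold i next j ≢ i
  next^≢ i 0<j j≤4 = fold-next-≢ i 0<j (s≤s (≤-trans j≤4 4≤k))

  prev≡⇒next≡ : ∀ {i j} → prev i ≡ j → next j ≡ i
  prev≡⇒next≡ {i} prev-i≡j = trans (cong next (≡.sym prev-i≡j)) (next-prev i)

  prev≢next : ∀ i → prev i ≢ next i
  prev≢next i = next^≢ i z<s (s≤s (s≤s z≤n)) ∘ prev≡⇒next≡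

  prev-adj : ∀ i → Adj G (c (prev i)) (c i)
  prev-adj i = ≡.subst (λ j → Adj G (c (prev i)) (c j)) (next-prev i) (adj (prev i))

  prev-nonadj-next : ∀ i → ¬ Adj G (c (prev i)) (c (next i))
  prev-nonadj-next i = nonadj (prev i) (next i) (prev≢next i)
    (λ next-i≡next-prev-i → next^≢ i z<s (s≤s z≤n) (trans next-i≡next-prev-i (next-prev i)))
    (next^≢ i z<s (s≤s (s≤s (s≤s z≤n))) ∘ prev≡⇒next≡)

  adjacent-indices : ∀ i j → Adj G (c i) (c j) → j ≡ next i ⊎ i ≡ next j
  adjacent-indices i j c-i~c-j with i ≟ j
  ... | yes refl = ⊥-elim (irr G c-i~c-j)
  ... | no i≢j with j ≟ next i
  ...   | yes j≡next-i = inj₁ j≡next-i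
  ...   | no j≢next-i with i ≟ next j
  ...     | yes i≡next-j = inj₂ i≡next-j
  ...     | no i≢next-j = ⊥-elim (nonadj i j i≢j j≢next-i i≢next-j c-i~c-j)

  common-neighbour-index : ∀ i j → Adj G (c j) (c (prev i)) → Adj G (c j) (c (next i)) → j ≡ i
  common-neighbour-index i j j~prev j~next
    with adjacent-indices j (prev i) j~prev | adjacent-indices j (next i) j~next
  ... | inj₂ j≡next-prev-i | _                  = trans j≡next-prev-i (next-prev i)
  ... | inj₁ _             | inj₁ next-i≡next-j = ≡.sym (next-injective next-i≡next-j)
  ... | inj₁ prev-i≡next-j | inj₂ j≡next²-i     = ⊥-elim (next^≢ i z<s ≤-refl (begin
    next (next (next (next i))) ≡⟨ cong (next ∘ next) j≡next²-i ⟨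
    next (next j)               ≡⟨ prev≡⇒next≡ prev-i≡next-j ⟩
    i                           ∎))

  module _ (good : HasGoodNeighbors (asGraphOn G) c) where

    common-neighbour : ∀ i {u} → Adj G u (c (prev i)) → Adj G u (c (next i)) →
      u ≡ c i ⊎ Adj G u (c i)
    common-neighbour i {u} u~prev u~next with any? (λ j → u ≟ c j)
    ... | yes (j , refl) = inj₁ (cong c (common-neighbour-index i j u~prev u~next))
    ... | no off-cycle   = inj₂ (good u tt (λ j u≡c-j → off-cycle (j , u≡c-j)) i u~prev u~next)

module BicliqueCycle (G : Graph) (k : ℕ) (4≤k : 4 ≤ k) {c : Fin (suc k) → Fin (m G)}
    (cycle : IsInducedCycle (asGraphOn G) c) (good : HasGoodNeighbors (asGraphOn G) c)
    {B : Fin (suc k) → Subset (m G)} (bicliques : ∀ i → IsBiclique G (B i))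
    (three∈B : ∀ i → (c (prev i) ∈ B i) × (c i ∈ B i) × (c (next i) ∈ B i)) where
  open InducedCycle G k 4≤k cycle
  open IsInducedCycle cycle

  prev∈B : ∀ i → c (prev i) ∈ B i
  prev∈B i = proj₁ (three∈B i)

  centre∈B : ∀ i → c i ∈ B i
  centre∈B i = proj₁ (proj₂ (three∈B i))

  next∈B : ∀ i → c (next i) ∈ B i
  next∈B i = proj₂ (proj₂ (three∈B i))

  B-star : ∀ i → IsStarAt G (B i) (c i)
  B-star i = completeBipartite⇒star (proj₁ (bicliques i)) (centre∈B i) (prev∈B i) (next∈B i)
    (prev-adj i) (sym G (adj i)) (common-neighbour good i)

  B⊆N[c] : ∀ i u → u ∈ B i → (N[ G ]∋ c i) u
  B⊆N[c] i u = IsStarAt.⊆-N (B-star i)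

  B-injective : ∀ i j → B i ≡ B j → i ≡ j
  B-injective i j B-i≡B-j = inj i j (two-neighbours⇒centre j-star (centre∈B i) (prev∈B i) (next∈B i)
    (prev-adj i) (sym G (adj i)) (prev≢next i ∘ inj (prev i) (next i)))
    where
    j-star : IsStarAt G (B i) (c j)
    j-star = ≡.subst (λ S → IsStarAt G S (c j)) (≡.sym B-i≡B-j) (B-star j)

  B-adjacent : ∀ i → B i ≢ B (next i) × ShareEdge G (B i) (B (next i))
  B-adjacent i = next^≢ i z<s (s≤s z≤n) ∘ ≡.sym ∘ B-injective i (next i)
               , c i , c (next i) , centre∈B i , next∈B i
               , ≡.subst (λ j → c j ∈ B (next i)) (prev-next i) (prev∈B (next i))
               , centre∈B (next i) , adj i

  B-nonadjacent : ∀ i j → i ≢ j → j ≢ next i → i ≢ next j →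
    ¬ (B i ≢ B j × ShareEdge G (B i) (B j))
  B-nonadjacent i j i≢j j≢next-i i≢next-j (_ , share)
    with shared-edge-of-stars (B-star i) (B-star j) share
  ... | inj₁ c-i≡c-j = i≢j (inj i j c-i≡c-j)
  ... | inj₂ c-i~c-j = nonadj i j i≢j j≢next-i i≢next-j c-i~c-j

  B-cycle : IsInducedCycle (KBe G) B
  B-cycle = record { vert = bicliques ; inj = B-injective ; adj = B-adjacent ; nonadj = B-nonadjacent }

  B-good-neighbours : HasGoodNeighbors (KBe G) B
  B-good-neighbours S S-biclique S≢B i (_ , share-prev) (_ , share-next)
    with shared-edge⇒centre (B-star (prev i)) share-prev
  ... | x , (x∈S , x∈B-prev , x~prev) , prev∈S =
    S≢B i , c (prev i) , c i , prev∈S , centre∈S , prev∈B i , centre∈B i , prev-adj i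
    where
    next∈S : c (next i) ∈ S
    next∈S = proj₂ (proj₂ (shared-edge⇒centre (B-star (next i)) share-next))

    x~next : Adj G x (c (next i))
    x~next = adj-¬adj⇒adj (bipartition {G} (proj₁ S-biclique)) x∈S prev∈S next∈S x~prev (prev-nonadj-next i)

    centre∈S : c i ∈ S
    centre∈S with common-neighbour good i x~prev x~next
    ... | inj₁ refl = x∈S
    ... | inj₂ x~c-i = ⊥-elim (leaves-nonadjacent (B-star (prev i)) x∈B-prev
            (≡.subst (λ j → c j ∈ B (prev i)) (next-prev i) (next∈B (prev i)))
            x~prev (sym G (prev-adj i)) x~c-i)

proposition2 : (G : Graph) (n : ℕ) → n ≥ 5 →
    (c : Fin n → Fin (m G)) →
    IsInducedCycle (asGraphOn G) c →
    HasGoodNeighbors (asGraphOn G) c →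
    (B : Fin n → Subset (m G)) →
    (∀ i → IsBiclique G (B i)) →
    (∀ i → (c (prev i) ∈ B i) × (c i ∈ B i) × (c (next i) ∈ B i)) →
    (∀ i u → u ∈ B i → (N[ G ]∋ c i) u) ×
    IsInducedCycle (KBe G) B ×
    HasGoodNeighbors (KBe G) B
proposition2 G (suc k) (s≤s 4≤k) c cycle good B bicliques three∈B =
  B⊆N[c] , B-cycle , B-good-neighbours
  where open BicliqueCycle G k 4≤k cycle good bicliques three∈B
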